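{- For all integers $m,n\geq 1$, the bistar $B_{m,n}$ is total prime.
   Context: All graphs are finite and simple. For a graph $G$ with vertex set $V$ and edge set $E$, a total prime labeling is a bijection $\ell: V\cup E\to\{1,2,\ldots,|V|+|E|\}$ such that (i) for every pair of adjacent vertices $u,v$, $\gcd(\ell(u),\ell(v))=1$, and (ii) for every vertex $v$ of degree at least 2, the greatest common divisor of the labels $\ell(uv)$ over all edges $uv$ incident to $v$ equals 1. A graph is total prime if it admits a total prime labeling. The bistar $B_{m,n}$ is obtained from the stars $K_{1,m}$ (center $u$, leaves $w_1,\ldots,w_m$) and $K_{1,n}$ (center $v$, leaves $x_1,\ldots,x_n$), taken vertex-disjoint, by adding the edge $uv$. -}

module Defs where

open import Data.Nat using (ℕ; zero; suc; _+_; _≤_)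
open import Data.Nat.GCD using (gcd)
open import Data.Fin using (Fin; zero; suc; toℕ; splitAt; _↑ˡ_; _↑ʳ_; _≟_)
open import Data.Sum using (_⊎_; inj₁; inj₂)
open import Data.Product using (_×_; _,_; proj₁; proj₂; Σ)
open import Data.List using (List; foldr; map; length; filterᵇ; allFin)
open import Data.Bool using (_∨_)
open import Relation.Nullary.Decidable using (isYes)
open import Relation.Binary.PropositionalEquality using (_≡_)
open import Function.Bundles using (_⤖_; Bijection)

record Graph : Set where
  field
    nV   : ℕ
    nE   : ℕ
    ends : Fin nE → Fin nV × Fin nV

module _ (G : Graph) where
  open Graph G

  Elem : Set
  Elem = Fin nV ⊎ Fin nE

  incident : Fin nV → List (Fin nE)
  incident v = filterᵇ (λ e → isYes (v ≟ proj₁ (ends e)) ∨ isYes (v ≟ proj₂ (ends e))) (allFin nE)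

  degree : Fin nV → ℕ
  degree v = length (incident v)

  gcdList : List ℕ → ℕ
  gcdList = foldr gcd 0

  -- A total prime labeling: a bijection V ⊎ E → {1,…,|V|+|E|},
  -- represented as a bijection onto Fin (nV + nE), label x = 1 + toℕ (f x).
  record TotalPrimeLabeling : Set where
    field
      bij : Elem ⤖ Fin (nV + nE)
    label : Elem → ℕ
    label x = suc (toℕ (Bijection.to bij x))
    field
      adjCoprime  : ∀ e → gcd (label (inj₁ (proj₁ (ends e)))) (label (inj₁ (proj₂ (ends e)))) ≡ 1
      edgeCoprime : ∀ v → 2 ≤ degree v → gcdList (map (λ e → label (inj₂ e)) (incident v)) ≡ 1

  TotalPrime : Set
  TotalPrime = TotalPrimeLabeling

-- The bistar B_{m,n}.
-- Vertices Fin (2 + (m + n)): 0 = u, 1 = v, 2+i = w_i (i < m), 2+m+j = x_j (j < n).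
-- Edges Fin (1 + (m + n)): 0 = uv, 1+i = u w_i, 1+m+j = v x_j.
bistarEnds : (m n : ℕ) → Fin (suc (m + n)) → Fin (suc (suc (m + n))) × Fin (suc (suc (m + n)))
bistarEnds m n zero = zero , suc zero
bistarEnds m n (suc k) with splitAt m k
... | inj₁ i = zero , suc (suc (i ↑ˡ n))
... | inj₂ j = suc zero , suc (suc (m ↑ʳ j))

Bistar : ℕ → ℕ → Graph
Bistar m n = record { nV = suc (suc (m + n)) ; nE = suc (m + n) ; ends = bistarEnds m n }

-- Give u, w₁, …, w_m, uv, x₁, …, x_n the odd labels 1, 3, 5, … in this order, and v, uw₁, …, uw_m,
-- vx₁, …, vx_n the even labels 2, 4, 6, … in this order.  Every edge then has an endpoint labelled 1,
-- or joins v (label 2) to an odd-labelled x_j.  The edges uw_m, uv, vx₁ get the consecutive labels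
-- 2m+2, 2m+3, 2m+4, so the edge labels at u and at v have gcd 1, and all other vertices are leaves.
-- The labelling is injective into {1, …, |V|+|E|}, hence bijective by counting.
module Submission where

open import Defs
open import Data.Nat using (ℕ; suc; _+_; _*_; _≤_; _<_; z≤n; s≤s; s≤s⁻¹)
open import Data.Nat.Properties using (suc-injective; *-monoʳ-<; +-comm; +-identityʳ; *-suc; *-cancelˡ-≡; *-monoʳ-≤; even≢odd; 1+n≰n; <⇒≱)
open import Data.Nat.Divisibility using (_∣_; ∣1⇒≡1; ∣m+n∣m⇒∣n; ∣m⇒∣m*n; ∣-trans)
open import Data.Nat.GCD using (gcd; gcd[m,n]∣m; gcd[m,n]∣n; gcd-zeroˡ)
open import Data.Fin using (Fin; zero; suc; toℕ; fromℕ; fromℕ<; splitAt; _↑ˡ_; _↑ʳ_; punchIn; punchOut; _≟_)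
open import Data.Fin.Properties using (toℕ-injective; toℕ<n; toℕ-fromℕ<; toℕ-fromℕ; toℕ-↑ˡ; toℕ-↑ʳ; splitAt-↑ˡ; splitAt-↑ʳ; splitAt⁻¹-↑ˡ; splitAt⁻¹-↑ʳ; punchInᵢ≢i; punchOut-injective; punchOut-cong; punchOut-punchIn; injective⇒≤; any?; +↔⊎)
open import Data.Sum using (_⊎_; inj₁; inj₂)
import Data.Sum as Sum
open import Data.Product using (_,_; proj₁; proj₂)
open import Data.Bool using (Bool; T; _∨_)
open import Data.Bool.Properties using (T-∨)
open import Data.List using ([]; _∷_; map; foldr; length; allFin)
open import Data.List.Properties using (map-cong)
open import Data.List.Membership.Propositional using (_∈_)
open import Data.List.Membership.Propositional.Properties using (∈-map⁺; ∈-filter⁺; ∈-filter⁻; ∈-allFin)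
open import Data.List.Relation.Unary.Any using (here; there)
open import Data.List.Relation.Unary.All using (_∷_)
open import Data.List.Relation.Unary.AllPairs using (_∷_)
open import Data.List.Relation.Unary.Unique.Propositional using (Unique)
open import Data.List.Relation.Unary.Unique.Propositional.Properties using (filter⁺; allFin⁺)
open import Relation.Nullary using (yes; no; contradiction)
open import Relation.Nullary.Decidable using (isYes; T?; toWitness; fromWitness)
open import Relation.Binary.PropositionalEquality using (_≡_; refl; sym; trans; cong; subst; subst₂)
open import Function using (_∘_; _↔_; _⇔_; Inverse; Injection; Equivalence; mk⤖; mk⇔)
open import Function.Definitions using (Injective; StrictlySurjective; Bijective)
open import Function.Consequences.Propositional using (strictlySurjective⇒surjective)
open import Function.Properties.Inverse using (↔⇒↣)

∣n∣1+n⇒≡1 : ∀ {d n} → d ∣ n → d ∣ suc n → d ≡ 1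
∣n∣1+n⇒≡1 {d} {n} d∣n d∣1+n = ∣1⇒≡1 (∣m+n∣m⇒∣n (subst (d ∣_) (+-comm 1 n) d∣1+n) d∣n)

gcd[2,1+2*n]≡1 : ∀ n → gcd 2 (suc (2 * n)) ≡ 1
gcd[2,1+2*n]≡1 n = ∣n∣1+n⇒≡1 (∣m⇒∣m*n n (gcd[m,n]∣m 2 (suc (2 * n)))) (gcd[m,n]∣n 2 _)

foldr-gcd∣ : ∀ {x xs} → x ∈ xs → foldr gcd 0 xs ∣ x
foldr-gcd∣ {xs = y ∷ ys} (here refl)  = gcd[m,n]∣m y (foldr gcd 0 ys)
foldr-gcd∣ {xs = y ∷ ys} (there x∈ys) = ∣-trans (gcd[m,n]∣n y (foldr gcd 0 ys)) (foldr-gcd∣ x∈ys)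

foldr-gcd≡1 : ∀ {n xs} → n ∈ xs → suc n ∈ xs → foldr gcd 0 xs ≡ 1
foldr-gcd≡1 n∈xs 1+n∈xs = ∣n∣1+n⇒≡1 (foldr-gcd∣ n∈xs) (foldr-gcd∣ 1+n∈xs)

unique∧constant⇒length≤1 : ∀ {A : Set} {c : A} {xs} →
                           Unique xs → (∀ {x} → x ∈ xs → x ≡ c) → length xs ≤ 1
unique∧constant⇒length≤1 {xs = []}        _                  _  = z≤n
unique∧constant⇒length≤1 {xs = _ ∷ []}    _                  _  = s≤s z≤n
unique∧constant⇒length≤1 {xs = _ ∷ _ ∷ _} ((x≢y ∷ _) ∷ _) ≡c =
  contradiction (trans (≡c (here refl)) (sym (≡c (there (here refl))))) x≢y

injective⇒strictlySurjective : ∀ {n} {f : Fin n → Fin n} →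
                               Injective _≡_ _≡_ f → StrictlySurjective _≡_ f
injective⇒strictlySurjective {suc n} {f} f-injective y with any? (λ x → f x ≟ y)
... | yes fx≡y = fx≡y
... | no  f≢y  = contradiction (injective⇒≤ g-injective) 1+n≰n
  where
  g : Fin (suc n) → Fin n
  g x = punchOut {i = y} (λ y≡fx → f≢y (x , sym y≡fx))

  g-injective : Injective _≡_ _≡_ g
  g-injective eq = f-injective (punchOut-injective {i = y} _ _ eq)

injective⇒bijective : ∀ {A : Set} {n} → Fin n ↔ A →
                      {f : A → Fin n} → Injective _≡_ _≡_ f → Bijective _≡_ _≡_ f
injective⇒bijective Fin↔A {f} f-injective = f-injective , strictlySurjective⇒surjective f-surjective
  where
  open Inverse Fin↔A using (to)
  f∘to-injective : Injective _≡_ _≡_ (f ∘ to)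
  f∘to-injective = Injection.injective (↔⇒↣ Fin↔A) ∘ f-injective

  f-surjective : StrictlySurjective _≡_ f
  f-surjective y with x , fx≡y ← injective⇒strictlySurjective f∘to-injective y = to x , fx≡y

2*n≡n+n : ∀ n → 2 * n ≡ n + n
2*n≡n+n n = cong (n +_) (+-identityʳ n)

interleave : ∀ {k} → Fin (suc k) ⊎ Fin k → ℕ
interleave (inj₁ i) = 2 * toℕ i
interleave (inj₂ j) = suc (2 * toℕ j)

interleave-injective : ∀ {k} → Injective _≡_ _≡_ (interleave {k})
interleave-injective {x = inj₁ i} {inj₁ i′} eq = cong inj₁ (toℕ-injective (*-cancelˡ-≡ _ _ 2 eq))
interleave-injective {x = inj₁ i} {inj₂ j′} eq = contradiction eq (even≢odd (toℕ i) (toℕ j′))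
interleave-injective {x = inj₂ j} {inj₁ i′} eq = contradiction (sym eq) (even≢odd (toℕ i′) (toℕ j))
interleave-injective {x = inj₂ j} {inj₂ j′} eq =
  cong inj₂ (toℕ-injective (*-cancelˡ-≡ _ _ 2 (suc-injective eq)))

interleave-< : ∀ {k} (x : Fin (suc k) ⊎ Fin k) → interleave x < suc k + k
interleave-< {k} (inj₁ i) = s≤s (subst (2 * toℕ i ≤_) (2*n≡n+n k) (*-monoʳ-≤ 2 (s≤s⁻¹ (toℕ<n i))))
interleave-< {k} (inj₂ j) = s≤s (subst (2 * toℕ j <_) (2*n≡n+n k) (*-monoʳ-< 2 (toℕ<n j)))

module _ (G : Graph) where
  open Graph G

  IsEndpoint : Fin nV → Fin nE → Set
  IsEndpoint w e = w ≡ proj₁ (ends e) ⊎ w ≡ proj₂ (ends e)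

  private
    isEndpoint? : Fin nV → Fin nE → Bool
    isEndpoint? w e = isYes (w ≟ proj₁ (ends e)) ∨ isYes (w ≟ proj₂ (ends e))

    T-isEndpoint? : ∀ w e → T (isEndpoint? w e) ⇔ IsEndpoint w e
    T-isEndpoint? w e = mk⇔ (Sum.map toWitness toWitness ∘ to) (from ∘ Sum.map fromWitness fromWitness)
      where open Equivalence (T-∨ {isYes (w ≟ proj₁ (ends e))} {isYes (w ≟ proj₂ (ends e))})

  ∈-incident⁺ : ∀ {w e} → IsEndpoint w e → e ∈ incident G w
  ∈-incident⁺ {w} {e} w∈e =
    ∈-filter⁺ (λ e → T? (isEndpoint? w e)) (∈-allFin e) (Equivalence.from (T-isEndpoint? w e) w∈e)

  ∈-incident⁻ : ∀ {w e} → e ∈ incident G w → IsEndpoint w e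
  ∈-incident⁻ {w} {e} e∈ =
    Equivalence.to (T-isEndpoint? w e) (proj₂ (∈-filter⁻ (λ e → T? (isEndpoint? w e)) {xs = allFin nE} e∈))

  incident-unique : ∀ w → Unique (incident G w)
  incident-unique w = filter⁺ (λ e → T? (isEndpoint? w e)) (allFin⁺ nE)

  degree≤1 : ∀ {w c} → (∀ {e} → IsEndpoint w e → e ≡ c) → degree G w ≤ 1
  degree≤1 {w} ≡c = unique∧constant⇒length≤1 (incident-unique w) (≡c ∘ ∈-incident⁻)

  consecutive⇒gcdList≡1 : ∀ {w e e′} (L : Fin nE → ℕ) → IsEndpoint w e → IsEndpoint w e′ →
                          L e′ ≡ suc (L e) → gcdList G (map L (incident G w)) ≡ 1
  consecutive⇒gcdList≡1 {w} L w∈e w∈e′ Le′≡1+Le = foldr-gcd≡1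
    (∈-map⁺ L (∈-incident⁺ w∈e))
    (subst (_∈ map L (incident G w)) Le′≡1+Le (∈-map⁺ L (∈-incident⁺ w∈e′)))

  mkTotalPrimeLabeling : (ℓ : Elem G → ℕ) → Injective _≡_ _≡_ ℓ → (∀ x → ℓ x < nV + nE) →
    (∀ e → gcd (suc (ℓ (inj₁ (proj₁ (ends e))))) (suc (ℓ (inj₁ (proj₂ (ends e))))) ≡ 1) →
    (∀ w → 2 ≤ degree G w → gcdList G (map (λ e → suc (ℓ (inj₂ e))) (incident G w)) ≡ 1) →
    TotalPrimeLabeling G
  mkTotalPrimeLabeling ℓ ℓ-injective ℓ< endpoints-coprime incident-coprime = record
    { bij         = mk⤖ (injective⇒bijective +↔⊎ to-injective)
    ; adjCoprime  = λ e → subst₂ (λ a b → gcd a b ≡ 1) (label≡ _) (label≡ _) (endpoints-coprime e)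
    ; edgeCoprime = λ w 2≤deg →
        subst (λ xs → gcdList G xs ≡ 1) (map-cong (label≡ ∘ inj₂) (incident G w)) (incident-coprime w 2≤deg)
    }
    where
    to : Elem G → Fin (nV + nE)
    to x = fromℕ< (ℓ< x)

    to-injective : Injective _≡_ _≡_ to
    to-injective {x} {y} eq =
      ℓ-injective (trans (sym (toℕ-fromℕ< (ℓ< x))) (trans (cong toℕ eq) (toℕ-fromℕ< (ℓ< y))))

    label≡ : ∀ x → suc (ℓ x) ≡ suc (toℕ (to x))
    label≡ x = cong (1 +_) (sym (toℕ-fromℕ< (ℓ< x)))

bistarEnds-↑ˡ : ∀ m n (i : Fin m) → bistarEnds m n (suc (i ↑ˡ n)) ≡ (zero , suc (suc (i ↑ˡ n)))
bistarEnds-↑ˡ m n i rewrite splitAt-↑ˡ m i n = refl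

bistarEnds-↑ʳ : ∀ m n (j : Fin n) → bistarEnds m n (suc (m ↑ʳ j)) ≡ (suc zero , suc (suc (m ↑ʳ j)))
bistarEnds-↑ʳ m n j rewrite splitAt-↑ʳ m n j = refl

leaf-endpoint : ∀ {m n t e} → IsEndpoint (Bistar m n) (suc (suc t)) e → e ≡ suc t
leaf-endpoint {e = zero} (inj₁ ())
leaf-endpoint {e = zero} (inj₂ ())
leaf-endpoint {m} {n} {e = suc k} w∈e with splitAt m k in eq | w∈e
... | inj₁ i | inj₂ refl = cong suc (sym (splitAt⁻¹-↑ˡ eq))
... | inj₂ j | inj₂ refl = cong suc (sym (splitAt⁻¹-↑ʳ eq))

module BistarLabelling (m n : ℕ) where

  uvRank : Fin (suc (m + n))
  uvRank = fromℕ m ↑ˡ n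

  toℕ-uvRank : toℕ uvRank ≡ m
  toℕ-uvRank = trans (toℕ-↑ˡ (fromℕ m) n) (toℕ-fromℕ m)

  -- inj₁ i stands for the odd label 2i+1 and inj₂ j for the even label 2j+2.
  rank : Elem (Bistar m n) → Fin (suc (suc (m + n))) ⊎ Fin (suc (m + n))
  rank (inj₁ zero)          = inj₁ zero
  rank (inj₁ (suc zero))    = inj₂ zero
  rank (inj₁ (suc (suc t))) = inj₁ (suc (punchIn uvRank t))
  rank (inj₂ zero)          = inj₁ (suc uvRank)
  rank (inj₂ (suc t))       = inj₂ (suc t)

  unrank : Fin (suc (suc (m + n))) ⊎ Fin (suc (m + n)) → Elem (Bistar m n)
  unrank (inj₁ zero)    = inj₁ zero
  unrank (inj₁ (suc i)) with uvRank ≟ i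
  ... | yes _          = inj₂ zero
  ... | no  uvRank≢i   = inj₁ (suc (suc (punchOut uvRank≢i)))
  unrank (inj₂ zero)    = inj₁ (suc zero)
  unrank (inj₂ (suc t)) = inj₂ (suc t)

  unrank-rank : ∀ x → unrank (rank x) ≡ x
  unrank-rank (inj₁ zero)          = refl
  unrank-rank (inj₁ (suc zero))    = refl
  unrank-rank (inj₁ (suc (suc t))) with uvRank ≟ punchIn uvRank t
  ... | yes uvRank≡ = contradiction (sym uvRank≡) (punchInᵢ≢i uvRank t)
  ... | no  _       =
    cong (λ t → inj₁ (suc (suc t))) (trans (punchOut-cong uvRank refl) (punchOut-punchIn uvRank))
  unrank-rank (inj₂ zero) with uvRank ≟ uvRank
  ... | yes _             = refl
  ... | no  uvRank≢uvRank = contradiction refl uvRank≢uvRank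
  unrank-rank (inj₂ (suc t))       = refl

  offset : Elem (Bistar m n) → ℕ
  offset = interleave ∘ rank

  offset-injective : Injective _≡_ _≡_ offset
  offset-injective {x} {y} eq =
    trans (sym (unrank-rank x))
          (trans (cong unrank (interleave-injective {x = rank x} {rank y} eq)) (unrank-rank y))

  endpoints-coprime : ∀ e → let (a , b) = bistarEnds m n e in
                      gcd (suc (offset (inj₁ a))) (suc (offset (inj₁ b))) ≡ 1
  endpoints-coprime zero = refl
  endpoints-coprime (suc k) with splitAt m k
  ... | inj₁ i = gcd-zeroˡ (suc (offset (inj₁ (suc (suc (i ↑ˡ n))))))
  ... | inj₂ j = gcd[2,1+2*n]≡1 (toℕ (suc (punchIn uvRank (m ↑ʳ j))))

module _ (m n : ℕ) where
  open BistarLabelling (suc m) (suc n)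

  private
    G : Graph
    G = Bistar (suc m) (suc n)

    edgeLabel : Fin (Graph.nE G) → ℕ
    edgeLabel e = suc (offset (inj₂ e))

    uwLast vxFirst : Fin (Graph.nE G)
    uwLast  = suc (fromℕ m ↑ˡ suc n)
    vxFirst = suc (suc m ↑ʳ zero)

    u∈uwLast : IsEndpoint G zero uwLast
    u∈uwLast = inj₁ (cong proj₁ (sym (bistarEnds-↑ˡ (suc m) (suc n) (fromℕ m))))

    v∈vxFirst : IsEndpoint G (suc zero) vxFirst
    v∈vxFirst = inj₁ (cong proj₁ (sym (bistarEnds-↑ʳ (suc m) (suc n) zero)))

    edgeLabel-uv : edgeLabel zero ≡ suc (edgeLabel uwLast)
    edgeLabel-uv = cong suc (*-suc 2 (suc (toℕ (fromℕ m ↑ˡ suc n))))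

    edgeLabel-vxFirst : edgeLabel vxFirst ≡ suc (edgeLabel zero)
    edgeLabel-vxFirst = cong (λ i → suc (suc (2 * suc i)))
      (trans (toℕ-↑ʳ (suc m) zero) (trans (+-identityʳ (suc m)) (sym toℕ-uvRank)))

  incident-coprime : ∀ w → 2 ≤ degree G w → gcdList G (map edgeLabel (incident G w)) ≡ 1
  incident-coprime zero _ =
    consecutive⇒gcdList≡1 G {e = uwLast} {e′ = zero} edgeLabel u∈uwLast (inj₁ refl) edgeLabel-uv
  incident-coprime (suc zero) _ =
    consecutive⇒gcdList≡1 G {e = zero} {e′ = vxFirst} edgeLabel (inj₂ refl) v∈vxFirst edgeLabel-vxFirst
  incident-coprime (suc (suc t)) 2≤deg = contradiction (degree≤1 G (leaf-endpoint {t = t})) (<⇒≱ 2≤deg)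

mainTheorem15 : (m n : ℕ) → 1 ≤ m → 1 ≤ n → TotalPrime (Bistar m n)
mainTheorem15 (suc m) (suc n) _ _ =
  mkTotalPrimeLabeling (Bistar (suc m) (suc n))
    offset offset-injective (interleave-< ∘ rank) endpoints-coprime (incident-coprime m n)
  where open BistarLabelling (suc m) (suc n)
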